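{- The strong Kalton constant for submodular set functions is $\tfrac12$. That is: (i) for every $n$ and every $\epsilon\ge0$, every submodular $\epsilon$-modular set function over $[n]$ is $\tfrac{\epsilon}{2}$-linear; and (ii) for every $\kappa<\tfrac12$ and every $\epsilon>0$ there exist $n$ and a submodular $\epsilon$-modular set function over $[n]$ that is not $\kappa\epsilon$-linear.
   Context: A set function over $[n]$ is a map $f:2^{[n]}\to\mathbb{R}$; it is submodular if $f(S)+f(T)\ge f(S\cup T)+f(S\cap T)$ for all $S,T$; $\epsilon$-modular if $|f(S)+f(T)-f(S\cup T)-f(S\cap T)|\le\epsilon$ for all $S,T$; linear if $f(S)=c_0+\sum_{i\in S}c_i$ for constants $c_i$; $\Delta$-linear if some linear $\ell$ satisfies $|f(S)-\ell(S)|\le\Delta$ for all $S$.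
   Formalization: The values of set functions, the parameters ε and κ, and the coefficients of linear functions are rational instead of real. -}

module Defs where

open import Data.Nat using (ℕ; zero; suc)
open import Data.Fin using (Fin; zero; suc)
open import Data.Fin.Subset using (Subset; _∪_; _∩_; inside; outside)
open import Data.Vec using ([]; _∷_)
open import Data.Rational using (ℚ; 0ℚ; _+_; _-_; _≤_; ∣_∣)
open import Data.Product using (Σ; _×_)
open import Relation.Binary.PropositionalEquality using (_≡_)

SetFun : ℕ → Set
SetFun n = Subset n → ℚ

sumOver : {n : ℕ} → (Fin n → ℚ) → Subset n → ℚ
sumOver {zero}  c []             = 0ℚ
sumOver {suc n} c (inside  ∷ S) = c zero + sumOver (λ i → c (suc i)) S
sumOver {suc n} c (outside ∷ S) = sumOver (λ i → c (suc i)) S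

Submodular : {n : ℕ} → SetFun n → Set
Submodular f = ∀ S T → f (S ∪ T) + f (S ∩ T) ≤ f S + f T

Modular : {n : ℕ} → ℚ → SetFun n → Set
Modular ε f = ∀ S T → ∣ f S + f T - f (S ∪ T) - f (S ∩ T) ∣ ≤ ε

IsLinear : {n : ℕ} → SetFun n → Set
IsLinear {n} ℓ = Σ ℚ λ c₀ → Σ (Fin n → ℚ) λ c → ∀ S → ℓ S ≡ c₀ + sumOver c S

ΔLinear : {n : ℕ} → ℚ → SetFun n → Set
ΔLinear {n} Δ f = Σ (SetFun n) λ ℓ → IsLinear ℓ × (∀ S → ∣ f S - ℓ S ∣ ≤ Δ)

{-# OPTIONS --safe #-}
-- Upper bound: a submodular f has a base vector c (built greedily), i.e.
-- f ∅ + c(S) ≤ f S for all S with equality at S = [n].  Applying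
-- ε-modularity to S and its complement gives f S ≤ f ∅ + c(S) + ε, so the
-- linear function f ∅ + ε/2 + c(S) is within ε/2 of f.
--
-- Lower bound: f S = ε·[S ≠ ∅] is submodular and ε-modular.  If a linear
-- function with coefficients c were within Δ of f, every c i would be at
-- least ε - 2Δ while c([n]) is at most ε + 2Δ; for Δ = κε with κ < 1/2
-- this fails once n (1/2 - κ) ≥ 1.
module Submission where

open import Defs
open import Data.Nat using (ℕ)
open import Data.Rational using (ℚ; 0ℚ; ½; _*_; _≤_; _<_)
open import Data.Product using (Σ; _×_)
open import Relation.Nullary using (¬_)

open import Algebra.Bundles using (CommutativeMonoid; CommutativeRing)
open import Data.Bool using (Bool; true; false; _∨_; if_then_else_; b≤b; f≤t)
  renaming (_≤_ to _≤ᵇ_)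
open import Data.Bool.Properties using (∨-commutativeMonoid; ≤-maximum)
open import Data.Fin using (Fin; zero; suc)
open import Data.Fin.Subset using (Subset; _∪_; _∩_; inside; outside; ⊥; ⊤; ∁; ⁅_⁆)
open import Data.Fin.Subset.Properties using (∪-identityˡ; ∪-inverseʳ; ∩-zeroˡ; ∩-inverseʳ; ∩-comm)
import Data.Integer as ℤ
import Data.Integer.Properties as ℤ
import Data.Nat as ℕ
import Data.Nat.Properties as ℕ
import Data.Sign as Sign
open import Data.Nat.Coprimality using (1-coprimeTo)
import Data.Nat.Coprimality as Coprime
open import Data.Product using (_,_; proj₁; proj₂)
open import Data.Rational using (mkℚ; 1ℚ; _+_; _-_; -_; ∣_∣; 1/_; *≤*; *<*; _/_; positive; nonNegative)
open import Data.Rational.Properties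
open import Data.Sum using (_⊎_; inj₁; inj₂)
open import Data.Vec using ([]; _∷_)
import Data.Vec.Functional as Vector
open import Level using (0ℓ)
open import Relation.Binary.PropositionalEquality
open import Relation.Nullary.Decidable using (dec⇒maybe)
open import Tactic.RingSolver using (solve-∀)
open import Tactic.RingSolver.Core.AlmostCommutativeRing
  using (AlmostCommutativeRing; fromCommutativeRing)

open import Algebra.Properties.CommutativeSemigroup
  (CommutativeMonoid.commutativeSemigroup ∨-commutativeMonoid) using (interchange)
open import Algebra.Properties.Semiring.Mult (CommutativeRing.semiring +-*-commutativeRing)
  using (×-assoc-*) renaming (_×_ to _·_)

ℚ-ring : AlmostCommutativeRing 0ℓ 0ℓ
ℚ-ring = fromCommutativeRing +-*-commutativeRing (λ p → dec⇒maybe (0ℚ ≟ p))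

p≤q⇒0≤q-p : ∀ {p q} → p ≤ q → 0ℚ ≤ q - p
p≤q⇒0≤q-p {p} {q} p≤q = begin
  0ℚ     ≡⟨ +-inverseʳ p ⟨
  p - p  ≤⟨ +-monoˡ-≤ (- p) p≤q ⟩
  q - p  ∎
  where open ≤-Reasoning

0≤q-p⇒p≤q : ∀ {p q} → 0ℚ ≤ q - p → p ≤ q
0≤q-p⇒p≤q {p} {q} 0≤q-p = begin
  p            ≡⟨ +-identityˡ p ⟨
  0ℚ + p       ≤⟨ +-monoˡ-≤ p 0≤q-p ⟩
  (q - p) + p  ≡⟨ [q-p]+p≡q q p ⟩
  q            ∎
  where
  open ≤-Reasoning
  [q-p]+p≡q : ∀ q p → (q - p) + p ≡ q
  [q-p]+p≡q = solve-∀ ℚ-ring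

p≤q⇒p-q≤0 : ∀ {p q} → p ≤ q → p - q ≤ 0ℚ
p≤q⇒p-q≤0 {p} {q} p≤q = begin
  p - q  ≤⟨ +-monoˡ-≤ (- q) p≤q ⟩
  q - q  ≡⟨ +-inverseʳ q ⟩
  0ℚ     ∎
  where open ≤-Reasoning

p<q⇒0<q-p : ∀ {p q} → p < q → 0ℚ < q - p
p<q⇒0<q-p {p} {q} p<q = begin-strict
  0ℚ     ≡⟨ +-inverseʳ p ⟨
  p - p  <⟨ +-monoˡ-< (- p) p<q ⟩
  q - p  ∎
  where open ≤-Reasoning

p≤∣p∣ : ∀ p → p ≤ ∣ p ∣
p≤∣p∣ p with ∣p∣≡p∨∣p∣≡-p p
... | inj₁ ∣p∣≡p  = ≤-reflexive (sym ∣p∣≡p)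
... | inj₂ ∣p∣≡-p = begin
  p      ≡⟨ neg-involutive p ⟨
  - - p  ≤⟨ neg-antimono-≤ 0≤-p ⟩
  0ℚ     ≤⟨ 0≤-p ⟩
  - p    ≡⟨ ∣p∣≡-p ⟨
  ∣ p ∣  ∎
  where
  open ≤-Reasoning
  0≤-p : 0ℚ ≤ - p
  0≤-p = subst (0ℚ ≤_) ∣p∣≡-p (0≤∣p∣ p)
  neg-involutive : ∀ p → - - p ≡ p
  neg-involutive = solve-∀ ℚ-ring

∣p∣≤q⇒p≤q : ∀ {p q} → ∣ p ∣ ≤ q → p ≤ q
∣p∣≤q⇒p≤q {p} = ≤-trans (p≤∣p∣ p)

∣p∣≤q⇒-p≤q : ∀ {p q} → ∣ p ∣ ≤ q → - p ≤ q
∣p∣≤q⇒-p≤q {p} ∣p∣≤q = ∣p∣≤q⇒p≤q (subst (_≤ _) (sym (∣-p∣≡∣p∣ p)) ∣p∣≤q)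

p≤q∧-p≤q⇒∣p∣≤q : ∀ {p q} → p ≤ q → - p ≤ q → ∣ p ∣ ≤ q
p≤q∧-p≤q⇒∣p∣≤q {p} p≤q -p≤q with ∣p∣≡p∨∣p∣≡-p p
... | inj₁ ∣p∣≡p  = subst (_≤ _) (sym ∣p∣≡p) p≤q
... | inj₂ ∣p∣≡-p = subst (_≤ _) (sym ∣p∣≡-p) -p≤q

0≤p≤q⇒∣p∣≤q : ∀ {p q} → 0ℚ ≤ p → p ≤ q → ∣ p ∣ ≤ q
0≤p≤q⇒∣p∣≤q {p} 0≤p p≤q =
  p≤q∧-p≤q⇒∣p∣≤q p≤q (≤-trans (neg-antimono-≤ 0≤p) (≤-trans 0≤p p≤q))

0≤p≤q⇒∣p-½q∣≤½q : ∀ {p q} → 0ℚ ≤ p → p ≤ q → ∣ p - ½ * q ∣ ≤ ½ * q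
0≤p≤q⇒∣p-½q∣≤½q {p} {q} 0≤p p≤q = p≤q∧-p≤q⇒∣p∣≤q upper lower
  where
  open ≤-Reasoning
  q-½q≡½q : ∀ q → q - ½ * q ≡ ½ * q
  q-½q≡½q = solve-∀ ℚ-ring
  -[p-½q]≡½q-p : ∀ p q → - (p - ½ * q) ≡ ½ * q - p
  -[p-½q]≡½q-p = solve-∀ ℚ-ring
  upper : p - ½ * q ≤ ½ * q
  upper = begin
    p - ½ * q  ≤⟨ +-monoˡ-≤ (- (½ * q)) p≤q ⟩
    q - ½ * q  ≡⟨ q-½q≡½q q ⟩
    ½ * q      ∎
  lower : - (p - ½ * q) ≤ ½ * q
  lower = begin
    - (p - ½ * q)  ≡⟨ -[p-½q]≡½q-p p q ⟩
    ½ * q - p      ≤⟨ +-monoʳ-≤ (½ * q) (neg-antimono-≤ 0≤p) ⟩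
    ½ * q + 0ℚ     ≡⟨ +-identityʳ (½ * q) ⟩
    ½ * q          ∎

∣p-q∣≤r⇒p-r≤q : ∀ p q {r} → ∣ p - q ∣ ≤ r → p - r ≤ q
∣p-q∣≤r⇒p-r≤q p q {r} ∣p-q∣≤r =
  0≤q-p⇒p≤q (subst (0ℚ ≤_) (r-[p-q]≡q-[p-r] r p q) (p≤q⇒0≤q-p (∣p∣≤q⇒p≤q ∣p-q∣≤r)))
  where
  r-[p-q]≡q-[p-r] : ∀ r p q → r - (p - q) ≡ q - (p - r)
  r-[p-q]≡q-[p-r] = solve-∀ ℚ-ring

∣p-q∣≤r⇒q≤p+r : ∀ p q {r} → ∣ p - q ∣ ≤ r → q ≤ p + r
∣p-q∣≤r⇒q≤p+r p q {r} ∣p-q∣≤r =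
  0≤q-p⇒p≤q (subst (0ℚ ≤_) (r+[p-q]≡[p+r]-q r p q) (p≤q⇒0≤q-p (∣p∣≤q⇒-p≤q ∣p-q∣≤r)))
  where
  r+[p-q]≡[p+r]-q : ∀ r p q → r - - (p - q) ≡ (p + r) - q
  r+[p-q]≡[p+r]-q = solve-∀ ℚ-ring

∣[p-p′]-[q-q′]∣≤r+r′ : ∀ p p′ q q′ {r r′} → ∣ p - q ∣ ≤ r → ∣ p′ - q′ ∣ ≤ r′ →
                       ∣ (p - p′) - (q - q′) ∣ ≤ r + r′
∣[p-p′]-[q-q′]∣≤r+r′ p p′ q q′ {r} {r′} ∣p-q∣≤r ∣p′-q′∣≤r′ = begin
  ∣ (p - p′) - (q - q′) ∣  ≡⟨ cong ∣_∣ (regroup p p′ q q′) ⟩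
  ∣ (p - q) - (p′ - q′) ∣  ≤⟨ ∣p-q∣≤∣p∣+∣q∣ (p - q) (p′ - q′) ⟩
  ∣ p - q ∣ + ∣ p′ - q′ ∣  ≤⟨ +-mono-≤ ∣p-q∣≤r ∣p′-q′∣≤r′ ⟩
  r + r′                   ∎
  where
  open ≤-Reasoning
  regroup : ∀ p p′ q q′ → (p - p′) - (q - q′) ≡ (p - q) - (p′ - q′)
  regroup = solve-∀ ℚ-ring

n·1ℚ≡n : ∀ n → n · 1ℚ ≡ mkℚ (ℤ.+ n) 0 (Coprime.sym (1-coprimeTo n))
n·1ℚ≡n ℕ.zero    = refl
n·1ℚ≡n (ℕ.suc n) = begin
  1ℚ + n · 1ℚ                           ≡⟨ cong (1ℚ +_) (n·1ℚ≡n n) ⟩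
  -- _+_ unfolded on the two normal forms with denominator 1
  (ℤ.+ 1 ℤ.+ (Sign.+ ℤ.◃ n ℕ.* 1)) / 1  ≡⟨ cong (λ i → (ℤ.+ 1 ℤ.+ i) / 1) +◃n*1≡+n ⟩
  ℤ.+ ℕ.suc n / 1                       ≡⟨ ↥p/↧p≡p (mkℚ (ℤ.+ ℕ.suc n) 0 _) ⟩
  mkℚ (ℤ.+ ℕ.suc n) 0 _                 ∎
  where
  open ≡-Reasoning
  +◃n*1≡+n : Sign.+ ℤ.◃ n ℕ.* 1 ≡ ℤ.+ n
  +◃n*1≡+n = trans (ℤ.+◃n≡+n (n ℕ.* 1)) (cong ℤ.+_ (ℕ.*-identityʳ n))

archimedean : ∀ {r} → 0ℚ < r → Σ ℕ λ n → 1ℚ ≤ n · r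
archimedean {mkℚ ℤ.+0        _ _} (*<* (ℤ.+<+ ()))
archimedean {mkℚ ℤ.-[1+ _ ]  _ _} (*<* ())
archimedean {r@(mkℚ ℤ.+[1+ a ] d _)} _ = ℕ.suc d , (begin
  1ℚ                      ≡⟨ *-inverseˡ r ⟨
  1/ r * r                ≤⟨ *-monoʳ-≤-nonNeg r 1/r≤1+d ⟩
  (ℕ.suc d · 1ℚ) * r      ≡⟨ ×-assoc-* (ℕ.suc d) 1ℚ r ⟩
  ℕ.suc d · (1ℚ * r)      ≡⟨ cong (ℕ.suc d ·_) (*-identityˡ r) ⟩
  ℕ.suc d · r             ∎)
  where
  open ≤-Reasoning
  -- r = (1+a)/(1+d), so 1/r = (1+d)/(1+a) ≤ 1+d.
  1/r≤1+d : 1/ r ≤ ℕ.suc d · 1ℚ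
  1/r≤1+d rewrite n·1ℚ≡n (ℕ.suc d) = *≤* (ℤ.+≤+ (ℕ.*-monoʳ-≤ (ℕ.suc d) (ℕ.s≤s ℕ.z≤n)))

sumOver-⊥ : ∀ {n} (c : Fin n → ℚ) → sumOver c ⊥ ≡ 0ℚ
sumOver-⊥ {ℕ.zero}  c = refl
sumOver-⊥ {ℕ.suc _} c = sumOver-⊥ (λ i → c (suc i))

sumOver-⁅⁆ : ∀ {n} (c : Fin n → ℚ) (i : Fin n) → sumOver c ⁅ i ⁆ ≡ c i
sumOver-⁅⁆ c zero    = trans (cong (c zero +_) (sumOver-⊥ (λ i → c (suc i)))) (+-identityʳ (c zero))
sumOver-⁅⁆ c (suc i) = sumOver-⁅⁆ (λ j → c (suc j)) i

sumOver-∁ : ∀ {n} (c : Fin n → ℚ) (S : Subset n) → sumOver c S + sumOver c (∁ S) ≡ sumOver c ⊤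
sumOver-∁ c []            = +-identityʳ 0ℚ
sumOver-∁ c (inside  ∷ S) =
  trans (+-assoc (c zero) _ _) (cong (c zero +_) (sumOver-∁ (λ i → c (suc i)) S))
sumOver-∁ c (outside ∷ S) =
  trans (x+[y+z]≡y+[x+z] (sumOver c′ S) (c zero) (sumOver c′ (∁ S))) (cong (c zero +_) (sumOver-∁ c′ S))
  where
  c′ : Fin _ → ℚ
  c′ i = c (suc i)
  x+[y+z]≡y+[x+z] : ∀ x y z → x + (y + z) ≡ y + (x + z)
  x+[y+z]≡y+[x+z] = solve-∀ ℚ-ring

sumOver-⊤-lower : ∀ {n} {x} (c : Fin n → ℚ) → (∀ i → x ≤ c i) → n · x ≤ sumOver c ⊤
sumOver-⊤-lower {ℕ.zero}  c _   = ≤-refl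
sumOver-⊤-lower {ℕ.suc _} c x≤c =
  +-mono-≤ (x≤c zero) (sumOver-⊤-lower (λ i → c (suc i)) (λ i → x≤c (suc i)))

-- The upper bound

-- c is a base of the submodular polyhedron of S ↦ f S - f ⊥.
record IsBase {n} (f : SetFun n) (c : Fin n → ℚ) : Set where
  field
    below : ∀ S → f ⊥ + sumOver c S ≤ f S
    tight : f ⊥ + sumOver c ⊤ ≡ f ⊤

contract : ∀ {n} → SetFun (ℕ.suc n) → SetFun n
contract f T = f (inside ∷ T)

contract-submodular : ∀ {n} {f : SetFun (ℕ.suc n)} → Submodular f → Submodular (contract f)
contract-submodular sub S T = sub (inside ∷ S) (inside ∷ T)

submodular⇒diminishingReturns : ∀ {n} {f : SetFun (ℕ.suc n)} → Submodular f →
  ∀ T → f (inside ∷ T) + f ⊥ ≤ f ⁅ zero ⁆ + f (outside ∷ T)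
submodular⇒diminishingReturns {f = f} sub T =
  subst₂ (λ U I → f (inside ∷ U) + f (outside ∷ I) ≤ f ⁅ zero ⁆ + f (outside ∷ T))
         (∪-identityˡ T) (∩-zeroˡ T) (sub ⁅ zero ⁆ (outside ∷ T))

IsBase-∷ : ∀ {n} {f : SetFun (ℕ.suc n)} {c} → Submodular f → IsBase (contract f) c →
           IsBase f ((f ⁅ zero ⁆ - f ⊥) Vector.∷ c)
IsBase-∷ {f = f} {c} sub base = record { below = below′ ; tight = tight′ }
  where
  open IsBase base
  open ≤-Reasoning
  x+[[y-x]+z]≡y+z : ∀ x y z → x + ((y - x) + z) ≡ y + z
  x+[[y-x]+z]≡y+z = solve-∀ ℚ-ring
  x+z≡[[y+z]+x]-y : ∀ x y z → x + z ≡ ((y + z) + x) - y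
  x+z≡[[y+z]+x]-y = solve-∀ ℚ-ring
  [y+w]-y≡w : ∀ y w → (y + w) - y ≡ w
  [y+w]-y≡w = solve-∀ ℚ-ring
  below′ : ∀ S → f ⊥ + sumOver ((f ⁅ zero ⁆ - f ⊥) Vector.∷ c) S ≤ f S
  below′ (inside ∷ T) = begin
    f ⊥ + ((f ⁅ zero ⁆ - f ⊥) + sumOver c T)  ≡⟨ x+[[y-x]+z]≡y+z (f ⊥) (f ⁅ zero ⁆) (sumOver c T) ⟩
    f ⁅ zero ⁆ + sumOver c T                  ≤⟨ below T ⟩
    f (inside ∷ T)                            ∎
  below′ (outside ∷ T) = begin
    f ⊥ + sumOver c T                           ≡⟨ x+z≡[[y+z]+x]-y (f ⊥) (f ⁅ zero ⁆) (sumOver c T) ⟩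
    ((f ⁅ zero ⁆ + sumOver c T) + f ⊥) - f ⁅ zero ⁆
      ≤⟨ +-monoˡ-≤ (- f ⁅ zero ⁆) (+-monoˡ-≤ (f ⊥) (below T)) ⟩
    (f (inside ∷ T) + f ⊥) - f ⁅ zero ⁆
      ≤⟨ +-monoˡ-≤ (- f ⁅ zero ⁆) (submodular⇒diminishingReturns {f = f} sub T) ⟩
    (f ⁅ zero ⁆ + f (outside ∷ T)) - f ⁅ zero ⁆  ≡⟨ [y+w]-y≡w (f ⁅ zero ⁆) (f (outside ∷ T)) ⟩
    f (outside ∷ T)                             ∎
  tight′ : f ⊥ + sumOver ((f ⁅ zero ⁆ - f ⊥) Vector.∷ c) ⊤ ≡ f ⊤
  tight′ = trans (x+[[y-x]+z]≡y+z (f ⊥) (f ⁅ zero ⁆) (sumOver c ⊤)) tight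

submodular⇒base : ∀ {n} {f : SetFun n} → Submodular f → Σ (Fin n → ℚ) (IsBase f)
submodular⇒base {ℕ.zero} {f} _ = (λ ()) , record
  { below = λ { [] → ≤-reflexive (+-identityʳ (f [])) }
  ; tight = +-identityʳ (f [])
  }
submodular⇒base {ℕ.suc _} {f} sub =
  let (c , base) = submodular⇒base (contract-submodular {f = f} sub)
  in  _ , IsBase-∷ sub base

IsBase-gap≤ε : ∀ {n} {f : SetFun n} {c ε} → Modular ε f → IsBase f c →
               ∀ S → f S - (f ⊥ + sumOver c S) ≤ ε
IsBase-gap≤ε {f = f} {c} {ε} mod base S = begin
  f S - (f ⊥ + cS)                                        ≡⟨ regroup (f S) (f (∁ S)) (f ⊥) cS c∁S ⟩
  (f S + f (∁ S) - (f ⊥ + (cS + c∁S)) - f ⊥) + ((f ⊥ + c∁S) - f (∁ S))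
    ≡⟨ cong (λ t → (f S + f (∁ S) - t - f ⊥) + ((f ⊥ + c∁S) - f (∁ S))) ⊤-split ⟩
  (f S + f (∁ S) - f ⊤ - f ⊥) + ((f ⊥ + c∁S) - f (∁ S))
    ≤⟨ +-mono-≤ (∣p∣≤q⇒p≤q complement) (p≤q⇒p-q≤0 (below (∁ S))) ⟩
  ε + 0ℚ                                                  ≡⟨ +-identityʳ ε ⟩
  ε                                                       ∎
  where
  open IsBase base
  open ≤-Reasoning
  cS c∁S : ℚ
  cS  = sumOver c S
  c∁S = sumOver c (∁ S)
  regroup : ∀ a a′ b s s′ → a - (b + s) ≡ (a + a′ - (b + (s + s′)) - b) + ((b + s′) - a′)
  regroup = solve-∀ ℚ-ring
  ⊤-split : f ⊥ + (cS + c∁S) ≡ f ⊤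
  ⊤-split = trans (cong (f ⊥ +_) (sumOver-∁ c S)) tight
  complement : ∣ f S + f (∁ S) - f ⊤ - f ⊥ ∣ ≤ ε
  complement = subst₂ (λ U I → ∣ f S + f (∁ S) - f U - f I ∣ ≤ ε)
                      (∪-inverseʳ S) (∩-inverseʳ S) (mod S (∁ S))

submodular∧modular⇒½εLinear : (n : ℕ) (ε : ℚ) → 0ℚ ≤ ε → (f : SetFun n) →
                               Submodular f → Modular ε f → ΔLinear (½ * ε) f
submodular∧modular⇒½εLinear _ ε _ f sub mod =
  let (c , base) = submodular⇒base {f = f} sub
      open IsBase base
  in  (λ S → (f ⊥ + ½ * ε) + sumOver c S) , (f ⊥ + ½ * ε , c , λ _ → refl) , λ S →
        subst (λ x → ∣ x ∣ ≤ ½ * ε) (regroup (f S) (f ⊥) (sumOver c S) ε)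
          (0≤p≤q⇒∣p-½q∣≤½q (p≤q⇒0≤q-p (below S)) (IsBase-gap≤ε mod base S))
  where
  regroup : ∀ a b s e → (a - (b + s)) - ½ * e ≡ a - ((b + ½ * e) + s)
  regroup = solve-∀ ℚ-ring

-- The lower bound

modularDefect : ∀ {n} → SetFun n → Subset n → Subset n → ℚ
modularDefect f S T = f S + f T - f (S ∪ T) - f (S ∩ T)

defect∈[0,ε]⇒submodular∧modular : ∀ {n} {f : SetFun n} {ε} →
  (∀ S T → 0ℚ ≤ modularDefect f S T × modularDefect f S T ≤ ε) → Submodular f × Modular ε f
defect∈[0,ε]⇒submodular∧modular {f = f} bounds =
  (λ S T → 0≤q-p⇒p≤q
    (subst (0ℚ ≤_) (regroup (f S) (f T) (f (S ∪ T)) (f (S ∩ T))) (proj₁ (bounds S T)))) ,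
  (λ S T → 0≤p≤q⇒∣p∣≤q (proj₁ (bounds S T)) (proj₂ (bounds S T)))
  where
  regroup : ∀ a b c d → a + b - c - d ≡ (a + b) - (c + d)
  regroup = solve-∀ ℚ-ring

isNonempty : ∀ {n} → Subset n → Bool
isNonempty []      = false
isNonempty (x ∷ S) = x ∨ isNonempty S

isNonempty-⊥ : ∀ {n} → isNonempty (⊥ {n}) ≡ false
isNonempty-⊥ {ℕ.zero}  = refl
isNonempty-⊥ {ℕ.suc n} = isNonempty-⊥ {n}

isNonempty-⁅⁆ : ∀ {n} (i : Fin n) → isNonempty ⁅ i ⁆ ≡ true
isNonempty-⁅⁆ zero    = refl
isNonempty-⁅⁆ (suc i) = isNonempty-⁅⁆ i

isNonempty-∪ : ∀ {n} (S T : Subset n) → isNonempty (S ∪ T) ≡ isNonempty S ∨ isNonempty T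
isNonempty-∪ []      []      = refl
isNonempty-∪ (x ∷ S) (y ∷ T) =
  trans (cong ((x ∨ y) ∨_) (isNonempty-∪ S T)) (interchange x y (isNonempty S) (isNonempty T))

isNonempty-∩ˡ : ∀ {n} (S T : Subset n) → isNonempty (S ∩ T) ≤ᵇ isNonempty S
isNonempty-∩ˡ []            []            = b≤b
isNonempty-∩ˡ (inside  ∷ S) (inside  ∷ T) = b≤b
isNonempty-∩ˡ (inside  ∷ S) (outside ∷ T) = ≤-maximum _
isNonempty-∩ˡ (outside ∷ S) (_       ∷ T) = isNonempty-∩ˡ S T

isNonempty-∩ʳ : ∀ {n} (S T : Subset n) → isNonempty (S ∩ T) ≤ᵇ isNonempty T
isNonempty-∩ʳ S T = subst (λ U → isNonempty U ≤ᵇ isNonempty T) (∩-comm T S) (isNonempty-∩ˡ T S)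

indicator : ℚ → Bool → ℚ
indicator ε b = if b then ε else 0ℚ

private
  x+x-x-x≡0 : ∀ x → x + x - x - x ≡ 0ℚ
  x+x-x-x≡0 = solve-∀ ℚ-ring
  0+x-x-0≡0 : ∀ x → 0ℚ + x - x - 0ℚ ≡ 0ℚ
  0+x-x-0≡0 = solve-∀ ℚ-ring
  x+0-x-0≡0 : ∀ x → x + 0ℚ - x - 0ℚ ≡ 0ℚ
  x+0-x-0≡0 = solve-∀ ℚ-ring
  x+x-x-0≡x : ∀ x → x + x - x - 0ℚ ≡ x
  x+x-x-0≡x = solve-∀ ℚ-ring

-- s, t and i stand for the nonemptiness of S, T and S ∩ T.
indicator-defect≡0⊎≡ε : ∀ {ε s t i} → i ≤ᵇ s → i ≤ᵇ t →
  let d = indicator ε s + indicator ε t - indicator ε (s ∨ t) - indicator ε i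
  in  d ≡ 0ℚ ⊎ d ≡ ε
indicator-defect≡0⊎≡ε     {s = false} b≤b b≤b = inj₁ refl
indicator-defect≡0⊎≡ε {ε} {s = true}  b≤b b≤b = inj₁ (x+x-x-x≡0 ε)
indicator-defect≡0⊎≡ε {ε}             b≤b f≤t = inj₁ (0+x-x-0≡0 ε)
indicator-defect≡0⊎≡ε {ε}             f≤t b≤b = inj₁ (x+0-x-0≡0 ε)
indicator-defect≡0⊎≡ε {ε}             f≤t f≤t = inj₂ (x+x-x-0≡x ε)

nonemptyIndicator : ∀ {n} → ℚ → SetFun n
nonemptyIndicator ε S = indicator ε (isNonempty S)

nonemptyIndicator-submodular∧modular : ∀ {n ε} → 0ℚ ≤ ε →
  Submodular (nonemptyIndicator {n} ε) × Modular ε (nonemptyIndicator {n} ε)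
nonemptyIndicator-submodular∧modular {n} {ε} 0≤ε =
  defect∈[0,ε]⇒submodular∧modular {f = nonemptyIndicator ε} bounds
  where
  bounds : ∀ S T → 0ℚ ≤ modularDefect (nonemptyIndicator {n} ε) S T ×
                   modularDefect (nonemptyIndicator ε) S T ≤ ε
  bounds S T rewrite isNonempty-∪ S T
    with indicator-defect≡0⊎≡ε {ε} (isNonempty-∩ˡ S T) (isNonempty-∩ʳ S T)
  ... | inj₁ d≡0 = subst (λ d → 0ℚ ≤ d × d ≤ ε) (sym d≡0) (≤-refl , 0≤ε)
  ... | inj₂ d≡ε = subst (λ d → 0ℚ ≤ d × d ≤ ε) (sym d≡ε) (0≤ε , ≤-refl)

ΔLinear⇒incrementsClose : ∀ {n Δ} {f : SetFun n} → ΔLinear Δ f →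
  Σ (Fin n → ℚ) λ c → ∀ S → ∣ (f S - f ⊥) - sumOver c S ∣ ≤ Δ + Δ
ΔLinear⇒incrementsClose {Δ = Δ} {f} (ℓ , (c₀ , c , ℓ≡) , close) = c , λ S →
  subst (λ x → ∣ (f S - f ⊥) - x ∣ ≤ Δ + Δ) (increment S)
        (∣[p-p′]-[q-q′]∣≤r+r′ (f S) (f ⊥) (ℓ S) (ℓ ⊥) (close S) (close ⊥))
  where
  open ≡-Reasoning
  [x+y]-[x+0]≡y : ∀ x y → (x + y) - (x + 0ℚ) ≡ y
  [x+y]-[x+0]≡y = solve-∀ ℚ-ring
  increment : ∀ S → ℓ S - ℓ ⊥ ≡ sumOver c S
  increment S = begin
    ℓ S - ℓ ⊥                                ≡⟨ cong₂ _-_ (ℓ≡ S) (ℓ≡ ⊥) ⟩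
    (c₀ + sumOver c S) - (c₀ + sumOver c ⊥)
      ≡⟨ cong (λ z → (c₀ + sumOver c S) - (c₀ + z)) (sumOver-⊥ c) ⟩
    (c₀ + sumOver c S) - (c₀ + 0ℚ)           ≡⟨ [x+y]-[x+0]≡y c₀ (sumOver c S) ⟩
    sumOver c S                              ∎

nonemptyIndicator≤ε : ∀ {n ε} → 0ℚ ≤ ε → (S : Subset n) → nonemptyIndicator ε S ≤ ε
nonemptyIndicator≤ε 0≤ε S with isNonempty S
... | true  = ≤-refl
... | false = 0≤ε

nonemptyIndicator-increment : ∀ {n} ε (S : Subset n) →
  nonemptyIndicator ε S - nonemptyIndicator {n} ε ⊥ ≡ nonemptyIndicator ε S
nonemptyIndicator-increment {n} ε S =
  trans (cong (λ b → nonemptyIndicator ε S - indicator ε b) (isNonempty-⊥ {n}))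
        (+-identityʳ (nonemptyIndicator ε S))

nonemptyIndicator-incrementsClose⇒n·[ε-r]≤ε+r : ∀ {n ε r} → 0ℚ ≤ ε → (c : Fin n → ℚ) →
  (∀ S → ∣ (nonemptyIndicator ε S - nonemptyIndicator {n} ε ⊥) - sumOver c S ∣ ≤ r) →
  n · (ε - r) ≤ ε + r
nonemptyIndicator-incrementsClose⇒n·[ε-r]≤ε+r {n} {ε} {r} 0≤ε c close = begin
  n · (ε - r)        ≤⟨ sumOver-⊤-lower c ε-r≤c ⟩
  sumOver c ⊤        ≤⟨ ∣p-q∣≤r⇒q≤p+r (F ⊤ - F ⊥) (sumOver c ⊤) (close ⊤) ⟩
  (F ⊤ - F ⊥) + r    ≡⟨ cong (_+ r) (nonemptyIndicator-increment {n} ε ⊤) ⟩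
  F ⊤ + r            ≤⟨ +-monoˡ-≤ r (nonemptyIndicator≤ε {n} 0≤ε ⊤) ⟩
  ε + r              ∎
  where
  open ≤-Reasoning
  F : SetFun n
  F = nonemptyIndicator ε
  ε-r≤c : ∀ i → ε - r ≤ c i
  ε-r≤c i = ∣p-q∣≤r⇒p-r≤q ε (c i) (subst₂ (λ x y → ∣ x - y ∣ ≤ r)
    (trans (nonemptyIndicator-increment ε ⁅ i ⁆) (cong (indicator ε) (isNonempty-⁅⁆ i)))
    (sumOver-⁅⁆ c i) (close ⁅ i ⁆))

nonemptyIndicator-notκεLinear : ∀ {n κ ε} → κ < ½ → 0ℚ < ε → 1ℚ ≤ n · (½ - κ) →
  ¬ ΔLinear (κ * ε) (nonemptyIndicator {n} ε)
nonemptyIndicator-notκεLinear {n} {κ} {ε} κ<½ 0<ε 1≤n[½-κ] linear =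
  let (c , close) = ΔLinear⇒incrementsClose {f = nonemptyIndicator ε} linear
  in  <-irrefl refl (begin-strict
    ε + ε                      ≡⟨ *-identityˡ (ε + ε) ⟨
    1ℚ * (ε + ε)               ≤⟨ *-monoʳ-≤-nonNeg (ε + ε) {{nonNegative 0≤ε+ε}} 1≤n[½-κ] ⟩
    (n · (½ - κ)) * (ε + ε)    ≡⟨ ×-assoc-* n (½ - κ) (ε + ε) ⟩
    n · ((½ - κ) * (ε + ε))    ≡⟨ cong (n ·_) ([½-k][e+e]≡e-[ke+ke] κ ε) ⟩
    n · (ε - (κ * ε + κ * ε))  ≤⟨ nonemptyIndicator-incrementsClose⇒n·[ε-r]≤ε+r 0≤ε c close ⟩
    ε + (κ * ε + κ * ε)        <⟨ +-monoʳ-< ε 2κε<ε ⟩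
    ε + ε                      ∎)
  where
  open ≤-Reasoning
  0≤ε : 0ℚ ≤ ε
  0≤ε = <⇒≤ 0<ε
  0≤ε+ε : 0ℚ ≤ ε + ε
  0≤ε+ε = +-mono-≤ 0≤ε 0≤ε
  [½-k][e+e]≡e-[ke+ke] : ∀ k e → (½ - k) * (e + e) ≡ e - (k * e + k * e)
  [½-k][e+e]≡e-[ke+ke] = solve-∀ ℚ-ring
  ½e+½e≡e : ∀ e → ½ * e + ½ * e ≡ e
  ½e+½e≡e = solve-∀ ℚ-ring
  κε<½ε : κ * ε < ½ * ε
  κε<½ε = *-monoˡ-<-pos ε {{positive 0<ε}} κ<½
  2κε<ε : κ * ε + κ * ε < ε
  2κε<ε = begin-strict
    κ * ε + κ * ε  <⟨ +-mono-< κε<½ε κε<½ε ⟩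
    ½ * ε + ½ * ε  ≡⟨ ½e+½e≡e ε ⟩
    ε              ∎

submodular∧modular∧notκεLinear : (κ ε : ℚ) → κ < ½ → 0ℚ < ε →
  Σ ℕ λ n → Σ (SetFun n) λ f → Submodular f × Modular ε f × ¬ ΔLinear (κ * ε) f
submodular∧modular∧notκεLinear κ ε κ<½ 0<ε =
  let (n , 1≤n[½-κ]) = archimedean (p<q⇒0<q-p κ<½)
      (sub , mod)    = nonemptyIndicator-submodular∧modular {n} (<⇒≤ 0<ε)
  in  n , nonemptyIndicator ε , sub , mod , nonemptyIndicator-notκεLinear κ<½ 0<ε 1≤n[½-κ]

proposition5 :
    ((n : ℕ) (ε : ℚ) → 0ℚ ≤ ε → (f : SetFun n) →
      Submodular f → Modular ε f → ΔLinear (½ * ε) f)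
    ×
    ((κ ε : ℚ) → κ < ½ → 0ℚ < ε →
      Σ ℕ λ n → Σ (SetFun n) λ f →
        Submodular f × Modular ε f × ¬ ΔLinear (κ * ε) f)
proposition5 = submodular∧modular⇒½εLinear , submodular∧modular∧notκεLinear
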